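{- For every formula $\varphi\in\mathcal L^+$, its formula life tree $\mathfrak T_\varphi$ is a life tree. Moreover, for any child $\sigma$ of the root of $\mathfrak T_\varphi$, the subtree of $\mathfrak T_\varphi$ rooted at $\sigma$ is the $a$-grafting $\mathfrak T_\psi^a$ of the formula life tree $\mathfrak T_\psi$ of some subformula $\psi$ of $\varphi$, for some agent $a$.
   Context: Let $A$ be a finite set of agents and $P=A\sqcup\bigsqcup_{a\in A}P_a$ with $P_a$ countable pairwise disjoint sets of local atoms; $\mathcal L^+$: $\varphi::=a\mid p_a\mid\neg\varphi\mid(\varphi\wedge\varphi)\mid\widehat K_a\varphi$ ($a\in A$, $p_a\in P_a$). A life tree $\mathfrak T=(\mathcal T,\lambda)$ is a directed rooted tree $\mathcal T=(V,E)$ with a labeling $\lambda$ assigning to each node $\sigma\in V$ a set $\lambda(\sigma)\subseteq A$ and to each edge $(\sigma,\tau)\in E$ an agent $\lambda(\sigma,\tau)\in A$, such that $\lambda(\sigma,\tau)\in\lambda(\sigma)\cap\lambda(\tau)$ for each edge. The $a$-grafting $\mathfrak T^a$ of $\mathfrak T$ is obtained by adding $a$ to the label of its root. The formula life tree $\mathfrak T_\varphi$ is defined recursively: $\mathfrak T_a$ is a single root labeled $\varnothing$; $\mathfrak T_{p_a}$ is a single root labeled $\{a\}$; $\mathfrak T_{\neg\varphi}:=\mathfrak T_\varphi$; $\mathfrak T_{\varphi\wedge\psi}$ is the disjoint union of $\mathfrak T_\varphi$ and $\mathfrak T_\psi$ with their two roots merged into a single new root labeled by the union of the two root labels (all other labels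 unchanged); $\mathfrak T_{\widehat K_a\varphi}$ is obtained from the $a$-grafting $\mathfrak T_\varphi^a$ by adding a new root labeled $\{a\}$ and a new edge labeled $a$ from it to the root of $\mathfrak T_\varphi^a$ (all other labels unchanged). -}

module Defs where

open import Data.Nat using (ℕ)
open import Data.Fin using (Fin)
open import Data.Fin.Subset using (Subset; _∪_; _∈_; ⁅_⁆; ⊥)
open import Data.List using (List; []; _∷_; _++_)
open import Data.List.Relation.Unary.All using (All)
open import Data.Product using (_×_; _,_)

-- Agents: the finite set A is modelled as Fin n (n = number of agents).
-- Local atoms of agent a: p a k with k : ℕ (P_a countable, pairwise disjoint).
module _ (n : ℕ) where

  data Formula : Set where
    agent : Fin n → Formula
    atom  : Fin n → ℕ → Formula
    ¬′    : Formula → Formula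
    _∧′_  : Formula → Formula → Formula
    K̂     : Fin n → Formula → Formula

  -- Rooted labelled trees: a node carries its label λ(σ) ⊆ A and the list of
  -- its outgoing edges, each edge given by its label λ(σ,τ) and the subtree at τ.
  data Tree : Set where
    node : Subset n → List (Fin n × Tree) → Tree

rootLabel : ∀ {n} → Tree n → Subset n
rootLabel (node L _) = L

children : ∀ {n} → Tree n → List (Fin n × Tree n)
children (node _ cs) = cs

data IsLifeTree {n : ℕ} : Tree n → Set where
  node : ∀ {L : Subset n} {cs : List (Fin n × Tree n)} →
         All (λ { (b , t) → (b ∈ L) × (b ∈ rootLabel t) × IsLifeTree t }) cs →
         IsLifeTree (node L cs)

graft : ∀ {n} → Fin n → Tree n → Tree n
graft a (node L cs) = node (L ∪ ⁅ a ⁆) cs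

formulaTree : ∀ {n} → Formula n → Tree n
formulaTree (agent a)  = node ⊥ []
formulaTree (atom a k) = node ⁅ a ⁆ []
formulaTree (¬′ φ)     = formulaTree φ
formulaTree (φ ∧′ ψ) with formulaTree φ | formulaTree ψ
... | node L cs | node M ds = node (L ∪ M) (cs ++ ds)
formulaTree (K̂ a φ)    = node ⁅ a ⁆ ((a , graft a (formulaTree φ)) ∷ [])

data _⊑_ {n : ℕ} : Formula n → Formula n → Set where
  refl⊑ : ∀ {φ} → φ ⊑ φ
  ¬⊑    : ∀ {ψ φ} → ψ ⊑ φ → ψ ⊑ ¬′ φ
  ∧ˡ⊑   : ∀ {ψ φ χ} → ψ ⊑ φ → ψ ⊑ (φ ∧′ χ)
  ∧ʳ⊑   : ∀ {ψ φ χ} → ψ ⊑ χ → ψ ⊑ (φ ∧′ χ)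
  K̂⊑    : ∀ {ψ φ a} → ψ ⊑ φ → ψ ⊑ K̂ a φ

{-# OPTIONS --safe #-}
module Submission where

-- Merging two roots only enlarges the root label, and grafting
-- only enlarges the label of the target root, so every edge condition survives;
-- the one new edge of T_{K̂ a φ} is labelled a, which the new root and the grafted
-- root both contain. The children of a merged root are those of the two parts,
-- and the only child created is the grafted T_φ itself.

open import Defs
open import Data.Nat using (ℕ)
open import Data.Fin using (Fin)
open import Data.Fin.Subset using (Subset; _∪_; _⊆_; ⁅_⁆)
import Data.Fin.Subset as Subset
open import Data.Fin.Subset.Properties using (p⊆p∪q; q⊆p∪q; x∈⁅x⁆)
open import Data.List using (_++_)
open import Data.List.Membership.Propositional using (_∈_)
open import Data.List.Membership.Propositional.Properties using (∈-++⁻)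
open import Data.List.Relation.Unary.All using (All; []; _∷_)
import Data.List.Relation.Unary.All as All
open import Data.List.Relation.Unary.All.Properties using (++⁺)
open import Data.List.Relation.Unary.Any using (here)
open import Data.Product using (_×_; _,_; ∃-syntax)
import Data.Product as Product
open import Data.Sum using ([_,_]′)
open import Function using (_∘_)
open import Relation.Binary.PropositionalEquality using (_≡_; refl; sym; subst)

private
  variable
    n : ℕ
    L M : Subset n

-- Definitionally equal to the pattern-matching lambda inside IsLifeTree.node.
WellLabelledEdge : Subset n → Fin n × Tree n → Set
WellLabelledEdge L (b , t) = (b Subset.∈ L) × (b Subset.∈ rootLabel t) × IsLifeTree t

wellLabelledEdge-mono : L ⊆ M → ∀ {e} → WellLabelledEdge L e → WellLabelledEdge M e
wellLabelledEdge-mono L⊆M = Product.map₁ L⊆M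

isLifeTree-widenRoot : ∀ {cs} → L ⊆ M → IsLifeTree (node L cs) → IsLifeTree (node M cs)
isLifeTree-widenRoot L⊆M (node edges) = node (All.map (wellLabelledEdge-mono L⊆M) edges)

mergeRoots : Tree n → Tree n → Tree n
mergeRoots (node L cs) (node M ds) = node (L ∪ M) (cs ++ ds)

children-mergeRoots : (s t : Tree n) → children (mergeRoots s t) ≡ children s ++ children t
children-mergeRoots (node L cs) (node M ds) = refl

mergeRoots-isLifeTree : (s t : Tree n) → IsLifeTree s → IsLifeTree t → IsLifeTree (mergeRoots s t)
mergeRoots-isLifeTree (node L cs) (node M ds) (node edgesˡ) (node edgesʳ) = node (++⁺
  (All.map (wellLabelledEdge-mono (p⊆p∪q M)) edgesˡ)
  (All.map (wellLabelledEdge-mono (q⊆p∪q L M)) edgesʳ))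

graft-isLifeTree : (a : Fin n) (t : Tree n) → IsLifeTree t → IsLifeTree (graft a t)
graft-isLifeTree a (node L cs) = isLifeTree-widenRoot (p⊆p∪q ⁅ a ⁆)

∈-rootLabel-graft : (a : Fin n) (t : Tree n) → a Subset.∈ rootLabel (graft a t)
∈-rootLabel-graft a (node L cs) = q⊆p∪q L ⁅ a ⁆ (x∈⁅x⁆ a)

formulaTree-∧ : (φ ψ : Formula n) → formulaTree (φ ∧′ ψ) ≡ mergeRoots (formulaTree φ) (formulaTree ψ)
formulaTree-∧ φ ψ with formulaTree φ | formulaTree ψ
... | node L cs | node M ds = refl

formulaTree-isLifeTree : (φ : Formula n) → IsLifeTree (formulaTree φ)
formulaTree-isLifeTree (agent a)  = node []
formulaTree-isLifeTree (atom a k) = node []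
formulaTree-isLifeTree (¬′ φ)     = formulaTree-isLifeTree φ
formulaTree-isLifeTree (φ ∧′ ψ)   = subst IsLifeTree (sym (formulaTree-∧ φ ψ))
  (mergeRoots-isLifeTree _ _ (formulaTree-isLifeTree φ) (formulaTree-isLifeTree ψ))
formulaTree-isLifeTree (K̂ a φ)    = node ((x∈⁅x⁆ a , ∈-rootLabel-graft a (formulaTree φ) ,
  graft-isLifeTree a (formulaTree φ) (formulaTree-isLifeTree φ)) ∷ [])

GraftedSubformulaTree : Formula n → Tree n → Set
GraftedSubformulaTree φ σ = ∃[ ψ ] ∃[ a ] (ψ ⊑ φ × σ ≡ graft a (formulaTree ψ))

graftedSubformulaTree-mono : ∀ {φ φ′ : Formula n} {σ} → (∀ {ψ} → ψ ⊑ φ → ψ ⊑ φ′) →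
  GraftedSubformulaTree φ σ → GraftedSubformulaTree φ′ σ
graftedSubformulaTree-mono ⊑φ′ (ψ , a , ψ⊑φ , σ≡) = ψ , a , ⊑φ′ ψ⊑φ , σ≡

formulaTree-children : (φ : Formula n) {b : Fin n} {σ : Tree n} →
  (b , σ) ∈ children (formulaTree φ) → GraftedSubformulaTree φ σ
formulaTree-children (agent a)  ()
formulaTree-children (atom a k) ()
formulaTree-children (¬′ φ)     σ∈ = graftedSubformulaTree-mono ¬⊑ (formulaTree-children φ σ∈)
formulaTree-children (φ ∧′ ψ) {b} {σ} σ∈ =
  [ graftedSubformulaTree-mono ∧ˡ⊑ ∘ formulaTree-children φ
  , graftedSubformulaTree-mono ∧ʳ⊑ ∘ formulaTree-children ψ
  ]′ (∈-++⁻ (children (formulaTree φ)) σ∈′)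
  where
  σ∈′ : (b , σ) ∈ children (formulaTree φ) ++ children (formulaTree ψ)
  σ∈′ = subst ((b , σ) ∈_) (children-mergeRoots (formulaTree φ) (formulaTree ψ))
          (subst (λ t → (b , σ) ∈ children t) (formulaTree-∧ φ ψ) σ∈)
formulaTree-children (K̂ a φ) (here refl) = φ , a , K̂⊑ refl⊑ , refl

proposition4p6 : (n : ℕ) (φ : Formula n) →
    IsLifeTree (formulaTree φ) ×
    (∀ (b : Fin n) (σ : Tree n) → (b , σ) ∈ children (formulaTree φ) →
      ∃[ ψ ] ∃[ a ] (ψ ⊑ φ × σ ≡ graft a (formulaTree ψ)))
proposition4p6 n φ = formulaTree-isLifeTree φ , λ b σ → formulaTree-children φ
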